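{- Every cuboid of size $r_1\times r_2\times\cdots\times r_t$ satisfying condition $(\ast)$ whose first side has length $r_1\ge3$ and is very proper has a very proper decomposition.
   Context: Fix integers $n_1,\dots,n_s\ge2$, let $Q_n$ be the Boolean lattice of subsets of $[n]$, and $P=Q_{n_1}\times\cdots\times Q_{n_s}$ with product order and rank $\sum|a_i|$. For a nonempty $I\subseteq\{1,\dots,s\}$ let $P_I=\prod_{i\in I}Q_{n_i}$. A chain in $P_I$ skips no ranks if its ranks form an integer interval; its length is its number of elements. A chain $C$ in $P_I$ skipping no ranks is very proper if for all distinct $a,a'\in C$ there is $i\in I$ with $a_i\ne a'_i$ and $\{a_i,a'_i\}\ne\{\varnothing,[n_i]\}$; it is proper if this holds for all pairs of distinct elements except possibly the pair formed by the minimum and maximum of $P_I$. A cuboid is $C_1\times\cdots\times C_t\subseteq P$, where $I_1,\dots,I_t$ partition $\{1,\dots,s\}$ and each side $C_j$ is a chain in $P_{I_j}$ skipping no ranks; its size is $|C_1|\times\cdots\times|C_t|$. It is graded with rank of $(c_1,\dots,c_t)$ equal to $\sum_j(\text{position of }c_j\text{ in }C_j\text{ from }0)$ and top rank $N=\sum_j(|C_j|-1)$; a chain in it is symmetric if it has exactly one element of each rank $j,\dots,N-j$ for some $j$. A very proper decomposition of the cuboid is a partition of it into symmetric chains each of which is a very proper chain in $P$. Condition $(\ast)$: every side is a proper chain in its $P_{I_j}$, and every side of length $<5$ is very proper. -}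

module Defs where

open import Data.Nat using (ℕ; zero; suc; _+_; _∸_; _≤_)
open import Data.Bool using (Bool; true; false; if_then_else_)
open import Data.Fin using (Fin; zero; suc; toℕ; fromℕ)
open import Data.Fin.Properties using () renaming (_≟_ to _≟F_)
open import Data.Fin.Subset using (Subset; _∈_; _⊆_; ⊥; ⊤; ∣_∣)
open import Data.Vec using (lookup; tabulate)
open import Data.Product using (Σ; ∃; ∃-syntax; _×_; _,_)
open import Data.Sum using (_⊎_)
open import Relation.Binary.PropositionalEquality using (_≡_; _≢_)
open import Relation.Nullary using (¬_)
open import Relation.Nullary.Decidable using (⌊_⌋)

sumFin : ∀ {m} → (Fin m → ℕ) → ℕ
sumFin {zero} f = 0
sumFin {suc m} f = f zero + sumFin (λ i → f (suc i))

module _ {s : ℕ} (n : Fin s → ℕ) where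

  -- elements of P = Q_{n_1} × ... × Q_{n_s}; an element of P_I is represented
  -- by an element of P whose coordinates outside I are ignored.
  Elem : Set
  Elem = (i : Fin s) → Subset (n i)

  _≤[_]_ : Elem → Subset s → Elem → Set
  a ≤[ I ] b = ∀ i → i ∈ I → a i ⊆ b i

  rank : Subset s → Elem → ℕ
  rank I a = sumFin (λ i → if lookup I i then ∣ a i ∣ else 0)

  SkipsNoRanks : (I : Subset s) {r : ℕ} → (Fin r → Elem) → Set
  SkipsNoRanks I {r} c = ∀ (k k' : Fin r) → toℕ k' ≡ suc (toℕ k) →
    (c k ≤[ I ] c k') × rank I (c k') ≡ suc (rank I (c k))

  GoodPair : Subset s → Elem → Elem → Set
  GoodPair I a a' = ∃[ i ] (i ∈ I × a i ≢ a' i ×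
    ¬ ((a i ≡ ⊥ × a' i ≡ ⊤) ⊎ (a i ≡ ⊤ × a' i ≡ ⊥)))

  IsMinI : Subset s → Elem → Set
  IsMinI I a = ∀ i → i ∈ I → a i ≡ ⊥

  IsMaxI : Subset s → Elem → Set
  IsMaxI I a = ∀ i → i ∈ I → a i ≡ ⊤

  VeryProper : (I : Subset s) {r : ℕ} → (Fin r → Elem) → Set
  VeryProper I {r} c = SkipsNoRanks I c ×
    (∀ (k k' : Fin r) → k ≢ k' → GoodPair I (c k) (c k'))

  Proper : (I : Subset s) {r : ℕ} → (Fin r → Elem) → Set
  Proper I {r} c = SkipsNoRanks I c ×
    (∀ (k k' : Fin r) → k ≢ k' →
       GoodPair I (c k) (c k')
       ⊎ (IsMinI I (c k) × IsMaxI I (c k'))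
       ⊎ (IsMaxI I (c k) × IsMinI I (c k')))

  -- A cuboid C_1 × ... × C_t (t = suc t').  The partition I_1,...,I_t of the
  -- index set is given by block : Fin s → Fin t  (I_j = block⁻¹(j)), with nonempty blocks.
  record Cuboid : Set where
    field
      t'     : ℕ
      block  : Fin s → Fin (suc t')
      blockNonempty : ∀ j → ∃[ i ] (block i ≡ j)
      r      : Fin (suc t') → ℕ
      C      : (j : Fin (suc t')) → Fin (r j) → Elem   -- side C_j (coordinates in I_j matter)

    part : Fin (suc t') → Subset s
    part j = tabulate (λ i → ⌊ block i ≟F j ⌋)

    field
      sideChain : ∀ j → SkipsNoRanks (part j) (C j)

    Pos : Set
    Pos = (j : Fin (suc t')) → Fin (r j)

    _≈P_ : Pos → Pos → Set
    p ≈P q = ∀ j → p j ≡ q j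

    _≤C_ : Pos → Pos → Set
    p ≤C q = ∀ j → toℕ (p j) ≤ toℕ (q j)

    crank : Pos → ℕ
    crank p = sumFin (λ j → toℕ (p j))

    topRank : ℕ
    topRank = sumFin (λ j → r j ∸ 1)

    embed : Pos → Elem
    embed p i = C (block i) (p (block i)) i

  Star : Cuboid → Set
  Star K = ∀ j → Proper (part j) (C j) × (r j ≤ 4 → VeryProper (part j) (C j))
    where open Cuboid K

  record VPDecomposition (K : Cuboid) : Set where
    open Cuboid K
    field
      D     : ℕ
      len   : Fin D → ℕ
      ch    : (d : Fin D) → Fin (suc (len d)) → Pos
      step  : ∀ d (k k' : Fin (suc (len d))) → toℕ k' ≡ suc (toℕ k) →
                (ch d k ≤C ch d k') × crank (ch d k') ≡ suc (crank (ch d k))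
      symmetric : ∀ d → crank (ch d zero) + crank (ch d (fromℕ (len d))) ≡ topRank
      veryProperInP : ∀ d → VeryProper ⊤ (λ k → embed (ch d k))
      cover : ∀ p → ∃[ d ] ∃[ k ] (ch d k ≈P p)
      disjoint : ∀ d d' k k' → ch d k ≈P ch d' k' → Σ (d ≡ d') (λ _ → toℕ k ≡ toℕ k')

{-# OPTIONS --safe #-}
module Submission where

-- Only the shape of the cuboid matters: its side lengths and which sides are very proper.
-- On the grid of positions we build a symmetric chain decomposition in which two points of a
-- chain differ in some side j and, if side j is merely proper, are not its two ends; such a chain
-- embeds as a very proper chain of P, because on a proper side skipping no ranks the minimum and
-- maximum of P_I can only sit at the two ends.  Sides of length at most 4 are very proper by (∗).
--
-- The grid decomposition is built by induction on the total side length, the first side always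
-- being very proper.  If all sides are very proper, the first two span [a+1] × [b+1], which is a
-- hook of length a+b+1 (a new very proper side) together with a copy of [a] × [b] shifted by one.
-- If some side, of length q+3 ≥ 5, is merely proper and the first side has length p+3 ≥ 3, then
-- [p+3] × [q+3] is two chains, of lengths p+q+5 and p+q+3, that never use both ends of the
-- proper side within one column, together with a copy of [q+1] × [p+1] shifted by two; the three
-- new first sides again have length at least 3.

open import Defs
open import Data.Nat using (ℕ; _≤_)
open import Data.Fin using (Fin; zero)

open import Data.Bool using (Bool; true; false; if_then_else_)
open import Data.Empty using (⊥; ⊥-elim)
open import Data.Fin using (suc; toℕ; fromℕ; fromℕ<; inject₁)
open import Data.Fin.Properties
  using (+↔⊎; 0↔⊥; 1↔⊤; toℕ-fromℕ; toℕ-fromℕ<; toℕ<n; toℕ-injective; toℕ-inject₁; inject₁-injective)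
  renaming (_≟_ to _≟ᶠ_)
import Data.Fin.Properties as Fin
open import Data.Fin.Subset using (Subset; _∈_; _⊆_; ∣_∣; inside) renaming (⊥ to ∅; ⊤ to full)
open import Data.Fin.Subset.Properties using (∣p∣≤n; ∣⊥∣≡0; ∣⊤∣≡n; ∈⊤)
open import Data.List using (List; []; _∷_; _++_)
open import Data.List.Relation.Unary.All using (All; []; _∷_)
open import Data.List.Relation.Unary.All.Properties using (++⁺; ++⁻; ++⁻ʳ)
open import Data.Nat using (zero; suc; _+_; _∸_; _<_; z≤n; s≤s; s≤s⁻¹; _≟_; _≤?_)
open import Data.Nat.Properties
  using ( suc-injective; +-comm; +-assoc; +-suc; +-identityʳ; +-commutativeSemigroup
        ; +-cancelˡ-≡; +-cancelʳ-≡; +-cancelʳ-≤; +-mono-≤; +-monoˡ-≤; m≤m+n; m≤n+m; n≤1+n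
        ; ≤-refl; ≤-reflexive; ≤-trans; ≤-<-trans; ≤-antisym; ≤∧≢⇒<; <⇒≤; <⇒≢; ≰⇒>
        ; 0≢1+n; 1+n≰n; module ≤-Reasoning)
open import Algebra.Properties.CommutativeSemigroup +-commutativeSemigroup using (interchange; x∙yz≈y∙xz)
open import Data.Nat.Tactic.RingSolver using (solve-∀)
open import Data.Product using (Σ; ∃-syntax; _×_; _,_; proj₁; proj₂)
open import Data.Sum using (_⊎_; inj₁; inj₂)
import Data.Sum as Sum
open import Data.Sum.Function.Propositional using (_⊎-↔_)
open import Data.Unit using (⊤; tt)
open import Data.Vec using (lookup)
open import Data.Vec.Properties using (lookup∘tabulate; lookup-replicate; lookup⇒[]=; []=⇒lookup)
open import Function using (_∘_)
open import Function.Bundles using (_↔_; Inverse)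
open import Function.Properties.Inverse using (↔-trans)
open import Relation.Binary.PropositionalEquality
open import Relation.Nullary using (¬_; yes; no)
open import Relation.Nullary.Decidable using (⌊_⌋; isYes≗does; dec-true)

-- Grids and their chain decompositions

-- The length of a side, and whether the side is very proper.
Side : Set
Side = ℕ × Bool

Point : List Side → Set
Point []             = ⊤
Point ((ℓ , _) ∷ ls) = Fin ℓ × Point ls

height : ∀ ls → Point ls → ℕ
height []       _       = 0
height (_ ∷ ls) (u , x) = toℕ u + height ls x

topHeight : List Side → ℕ
topHeight []             = 0
topHeight ((ℓ , _) ∷ ls) = (ℓ ∸ 1) + topHeight ls

Covers : ∀ ls → Point ls → Point ls → Set
Covers []       _       _        = ⊥
Covers (_ ∷ ls) (u , x) (u' , y) =
  (toℕ u' ≡ suc (toℕ u) × x ≡ y) ⊎ (u ≡ u' × Covers ls x y)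

covers-height : ∀ ls x y → Covers ls x y → height ls y ≡ suc (height ls x)
covers-height (_ ∷ ls) (u , x) (u' , _) (inj₁ (u⋖u' , refl)) = cong (_+ height ls x) u⋖u'
covers-height (_ ∷ ls) (u , x) (_ , y)  (inj₂ (refl , x⋖y))  = trans (cong (toℕ u +_) (covers-height ls x y x⋖y)) (+-suc _ _)

NotEndPair : ℕ → Bool → ℕ → ℕ → Set
NotEndPair ℓ true  u u' = ⊤
NotEndPair ℓ false u u' = (suc u < ℓ × suc u' < ℓ) ⊎ (0 < u × 0 < u')

Separated : ∀ ls → Point ls → Point ls → Set
Separated []             _       _        = ⊥
Separated ((ℓ , v) ∷ ls) (u , x) (u' , y) =
  (u ≢ u' × NotEndPair ℓ v (toℕ u) (toℕ u')) ⊎ Separated ls x y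

record ChainFamily (ls : List Side) : Set₁ where
  field
    Index       : Set
    size        : ℕ
    enumeration : Fin size ↔ Index
    len         : Index → ℕ
    chain       : (i : Index) → Fin (suc (len i)) → Point ls
    covers      : ∀ i (k k' : Fin (suc (len i))) → toℕ k' ≡ suc (toℕ k) →
                  Covers ls (chain i k) (chain i k')
    symmetric   : ∀ i → height ls (chain i zero) + height ls (chain i (fromℕ (len i))) ≡ topHeight ls
    separated   : ∀ i (k k' : Fin (suc (len i))) → k ≢ k' → Separated ls (chain i k) (chain i k')
    injective   : ∀ i i' k k' → chain i k ≡ chain i' k' → Σ (i ≡ i') (λ _ → toℕ k ≡ toℕ k')

  OnChain : Point ls → Set
  OnChain x = ∃[ i ] ∃[ k ] (chain i k ≡ x)

open ChainFamily using (OnChain)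

Decomposition : List Side → Set₁
Decomposition ls = Σ (ChainFamily ls) λ F → ∀ x → OnChain F x

record GridEmbedding (ls' ls : List Side) : Set where
  field
    map           : Point ls' → Point ls
    shift         : ℕ
    height-map    : ∀ x → height ls (map x) ≡ shift + height ls' x
    -- Demanded only for inhabited ls': an empty grid is centred anywhere.
    centred       : Point ls' → shift + shift + topHeight ls' ≡ topHeight ls
    map-covers    : ∀ x y → Covers ls' x y → Covers ls (map x) (map y)
    map-separated : ∀ x y → Separated ls' x y → Separated ls (map x) (map y)
    map-injective : ∀ x y → map x ≡ map y → x ≡ y

mapFamily : ∀ {ls' ls} → GridEmbedding ls' ls → ChainFamily ls' → ChainFamily ls
mapFamily {ls'} {ls} e F = record
  { Index = Index ; size = size ; enumeration = enumeration ; len = len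
  ; chain     = λ i k → map (chain i k)
  ; covers    = λ i k k' k⋖k' → map-covers _ _ (covers i k k' k⋖k')
  ; symmetric = symmetric′
  ; separated = λ i k k' k≢k' → map-separated _ _ (separated i k k' k≢k')
  ; injective = λ i i' k k' eq → injective i i' k k' (map-injective _ _ eq)
  }
  where
  open ChainFamily F
  open GridEmbedding e
  symmetric′ : ∀ i → height ls (map (chain i zero)) + height ls (map (chain i (fromℕ (len i)))) ≡ topHeight ls
  symmetric′ i = begin
    height ls (map x) + height ls (map y)      ≡⟨ cong₂ _+_ (height-map x) (height-map y) ⟩
    (shift + height ls' x) + (shift + height ls' y) ≡⟨ interchange shift _ shift _ ⟩
    shift + shift + (height ls' x + height ls' y)  ≡⟨ cong (shift + shift +_) (symmetric i) ⟩
    shift + shift + topHeight ls'              ≡⟨ centred x ⟩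
    topHeight ls                               ∎
    where
    open ≡-Reasoning
    x = chain i zero
    y = chain i (fromℕ (len i))

onChain-map : ∀ {ls' ls} (e : GridEmbedding ls' ls) (F : ChainFamily ls') {x} →
              OnChain F x → OnChain (mapFamily e F) (GridEmbedding.map e x)
onChain-map e F (i , k , eq) = i , k , cong (GridEmbedding.map e) eq

emptyDecomposition : ∀ {ls} → (Point ls → ⊥) → Decomposition ls
emptyDecomposition {ls} empty = family , λ x → ⊥-elim (empty x)
  where
  family : ChainFamily ls
  family = record
    { Index = ⊥ ; size = 0 ; enumeration = 0↔⊥ ; len = λ () ; chain = λ ()
    ; covers = λ () ; symmetric = λ () ; separated = λ () ; injective = λ () }

lineDecomposition : ∀ a → Decomposition ((suc a , true) ∷ [])
lineDecomposition a = family , λ { (k , tt) → tt , k , refl }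
  where
  family : ChainFamily ((suc a , true) ∷ [])
  family = record
    { Index = ⊤ ; size = 1 ; enumeration = 1↔⊤ ; len = λ _ → a
    ; chain     = λ _ k → k , tt
    ; covers    = λ _ k k' k⋖k' → inj₁ (k⋖k' , refl)
    ; symmetric = λ _ → cong (_+ 0) (toℕ-fromℕ a)
    ; separated = λ _ k k' k≢k' → inj₁ (k≢k' , tt)
    ; injective = λ { _ _ k k' refl → refl , refl }
    }

module _ {ls : List Side} (F G : ChainFamily ls) where
  private
    module F = ChainFamily F
    module G = ChainFamily G

  Disjoint : Set
  Disjoint = ∀ i k j k' → F.chain i k ≡ G.chain j k' → ⊥

  unionFamily : Disjoint → ChainFamily ls
  unionFamily disjoint = record
    { Index = F.Index ⊎ G.Index
    ; size = F.size + G.size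
    ; enumeration = ↔-trans +↔⊎ (F.enumeration ⊎-↔ G.enumeration)
    ; len = len ; chain = chain ; covers = covers ; symmetric = symmetric
    ; separated = separated ; injective = injective
    }
    where
    len : F.Index ⊎ G.Index → ℕ
    len (inj₁ i) = F.len i
    len (inj₂ j) = G.len j
    chain : (i : F.Index ⊎ G.Index) → Fin (suc (len i)) → Point ls
    chain (inj₁ i) = F.chain i
    chain (inj₂ j) = G.chain j
    covers : ∀ i (k k' : Fin (suc (len i))) → toℕ k' ≡ suc (toℕ k) → Covers ls (chain i k) (chain i k')
    covers (inj₁ i) = F.covers i
    covers (inj₂ j) = G.covers j
    symmetric : ∀ i → height ls (chain i zero) + height ls (chain i (fromℕ (len i))) ≡ topHeight ls
    symmetric (inj₁ i) = F.symmetric i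
    symmetric (inj₂ j) = G.symmetric j
    separated : ∀ i (k k' : Fin (suc (len i))) → k ≢ k' → Separated ls (chain i k) (chain i k')
    separated (inj₁ i) = F.separated i
    separated (inj₂ j) = G.separated j
    injective : ∀ i i' k k' → chain i k ≡ chain i' k' → Σ (i ≡ i') (λ _ → toℕ k ≡ toℕ k')
    injective (inj₁ i) (inj₁ i') k k' eq with F.injective i i' k k' eq
    ... | refl , k≡k' = refl , k≡k'
    injective (inj₂ j) (inj₂ j') k k' eq with G.injective j j' k k' eq
    ... | refl , k≡k' = refl , k≡k'
    injective (inj₁ i) (inj₂ j) k k' eq = ⊥-elim (disjoint i k j k' eq)
    injective (inj₂ j) (inj₁ i) k k' eq = ⊥-elim (disjoint i k' j k (sym eq))

  onChain-union : ∀ disjoint {x} → OnChain F x ⊎ OnChain G x → OnChain (unionFamily disjoint) x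
  onChain-union _ (inj₁ (i , k , eq)) = inj₁ i , k , eq
  onChain-union _ (inj₂ (j , k , eq)) = inj₂ j , k , eq

disjoint-union : ∀ {ls} (F G H : ChainFamily ls) (F∩G : Disjoint F G) →
                 Disjoint F H → Disjoint G H → Disjoint (unionFamily F G F∩G) H
disjoint-union F G H _ F∩H G∩H (inj₁ i) = F∩H i
disjoint-union F G H _ F∩H G∩H (inj₂ j) = G∩H j

module _ {ls' ls : List Side} (e : GridEmbedding ls' ls) where
  open GridEmbedding e

  ImageOf : Point ls → Set
  ImageOf z = ∃[ x ] (map x ≡ z)

  onChain-image : (D : Decomposition ls') → ∀ {z} → ImageOf z → OnChain (mapFamily e (proj₁ D)) z
  onChain-image (F , onChain) (x , refl) = onChain-map e F (onChain x)

DisjointImages : ∀ {ls₁ ls₂ ls} → GridEmbedding ls₁ ls → GridEmbedding ls₂ ls → Set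
DisjointImages e₁ e₂ = ∀ x y → GridEmbedding.map e₁ x ≡ GridEmbedding.map e₂ y → ⊥

mapFamily-disjoint : ∀ {ls₁ ls₂ ls} (e₁ : GridEmbedding ls₁ ls) (e₂ : GridEmbedding ls₂ ls) →
                     DisjointImages e₁ e₂ → ∀ F G → Disjoint (mapFamily e₁ F) (mapFamily e₂ G)
mapFamily-disjoint e₁ e₂ e₁∩e₂ F G i k j k' = e₁∩e₂ _ _

glue₁ : ∀ {ls₁ ls} (e : GridEmbedding ls₁ ls) → (∀ z → ImageOf e z) →
        Decomposition ls₁ → Decomposition ls
glue₁ e onto D = mapFamily e (proj₁ D) , λ z → onChain-image e D (onto z)

glue₂ : ∀ {ls₁ ls₂ ls} (e₁ : GridEmbedding ls₁ ls) (e₂ : GridEmbedding ls₂ ls) →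
        DisjointImages e₁ e₂ → (∀ z → ImageOf e₁ z ⊎ ImageOf e₂ z) →
        Decomposition ls₁ → Decomposition ls₂ → Decomposition ls
glue₂ e₁ e₂ e₁∩e₂ onto D₁ D₂ =
  unionFamily F₁ F₂ F₁∩F₂ , λ z → onChain-union F₁ F₂ F₁∩F₂ (onChain z (onto z))
  where
  F₁ = mapFamily e₁ (proj₁ D₁)
  F₂ = mapFamily e₂ (proj₁ D₂)
  F₁∩F₂ = mapFamily-disjoint e₁ e₂ e₁∩e₂ (proj₁ D₁) (proj₁ D₂)
  onChain : ∀ z → ImageOf e₁ z ⊎ ImageOf e₂ z → OnChain F₁ z ⊎ OnChain F₂ z
  onChain z (inj₁ im) = inj₁ (onChain-image e₁ D₁ im)
  onChain z (inj₂ im) = inj₂ (onChain-image e₂ D₂ im)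

glue₃ : ∀ {ls₁ ls₂ ls₃ ls} (e₁ : GridEmbedding ls₁ ls) (e₂ : GridEmbedding ls₂ ls) (e₃ : GridEmbedding ls₃ ls) →
        DisjointImages e₁ e₂ → DisjointImages e₁ e₃ → DisjointImages e₂ e₃ →
        (∀ z → ImageOf e₁ z ⊎ ImageOf e₂ z ⊎ ImageOf e₃ z) →
        Decomposition ls₁ → Decomposition ls₂ → Decomposition ls₃ → Decomposition ls
glue₃ e₁ e₂ e₃ e₁∩e₂ e₁∩e₃ e₂∩e₃ onto D₁ D₂ D₃ =
  unionFamily F₁₂ F₃ F₁₂∩F₃ , λ z → onChain-union F₁₂ F₃ F₁₂∩F₃ (onChain z (onto z))
  where
  F₁ = mapFamily e₁ (proj₁ D₁)
  F₂ = mapFamily e₂ (proj₁ D₂)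
  F₃ = mapFamily e₃ (proj₁ D₃)
  F₁∩F₂ = mapFamily-disjoint e₁ e₂ e₁∩e₂ (proj₁ D₁) (proj₁ D₂)
  F₁₂ = unionFamily F₁ F₂ F₁∩F₂
  F₁₂∩F₃ = disjoint-union F₁ F₂ F₃ F₁∩F₂ (mapFamily-disjoint e₁ e₃ e₁∩e₃ (proj₁ D₁) (proj₁ D₃))
                                          (mapFamily-disjoint e₂ e₃ e₂∩e₃ (proj₁ D₂) (proj₁ D₃))
  onChain : ∀ z → ImageOf e₁ z ⊎ ImageOf e₂ z ⊎ ImageOf e₃ z → OnChain F₁₂ z ⊎ OnChain F₃ z
  onChain z (inj₁ im)        = inj₁ (onChain-union F₁ F₂ F₁∩F₂ (inj₁ (onChain-image e₁ D₁ im)))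
  onChain z (inj₂ (inj₁ im)) = inj₁ (onChain-union F₁ F₂ F₁∩F₂ (inj₂ (onChain-image e₂ D₂ im)))
  onChain z (inj₂ (inj₂ im)) = inj₂ (onChain-image e₃ D₃ im)

record GridIso (ls' ls : List Side) : Set where
  field
    to            : Point ls' → Point ls
    from          : Point ls → Point ls'
    to-from       : ∀ x → to (from x) ≡ x
    from-to       : ∀ y → from (to y) ≡ y
    height-to     : ∀ y → height ls (to y) ≡ height ls' y
    topHeight-≡   : topHeight ls' ≡ topHeight ls
    to-covers     : ∀ x y → Covers ls' x y → Covers ls (to x) (to y)
    to-separated  : ∀ x y → Separated ls' x y → Separated ls (to x) (to y)

  embedding : GridEmbedding ls' ls
  embedding = record
    { map = to ; shift = 0 ; height-map = height-to ; centred = λ _ → topHeight-≡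
    ; map-covers = to-covers ; map-separated = to-separated
    ; map-injective = λ x y eq → trans (sym (from-to x)) (trans (cong from eq) (from-to y))
    }

  onto : ∀ z → ImageOf embedding z
  onto z = from z , to-from z

idIso : ∀ ls → GridIso ls ls
idIso ls = record
  { to = λ x → x ; from = λ x → x ; to-from = λ _ → refl ; from-to = λ _ → refl
  ; height-to = λ _ → refl ; topHeight-≡ = refl
  ; to-covers = λ _ _ c → c ; to-separated = λ _ _ d → d }

_∘Iso_ : ∀ {ls₁ ls₂ ls₃} → GridIso ls₂ ls₃ → GridIso ls₁ ls₂ → GridIso ls₁ ls₃
J ∘Iso I = record
  { to = λ x → J.to (I.to x) ; from = λ x → I.from (J.from x)
  ; to-from = λ x → trans (cong J.to (I.to-from (J.from x))) (J.to-from x)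
  ; from-to = λ y → trans (cong I.from (J.from-to (I.to y))) (I.from-to y)
  ; height-to = λ y → trans (J.height-to _) (I.height-to y)
  ; topHeight-≡ = trans I.topHeight-≡ J.topHeight-≡
  ; to-covers = λ x y c → J.to-covers _ _ (I.to-covers x y c)
  ; to-separated = λ x y d → J.to-separated _ _ (I.to-separated x y d) }
  where
  module I = GridIso I
  module J = GridIso J

consIso : ∀ S {ls' ls} → GridIso ls' ls → GridIso (S ∷ ls') (S ∷ ls)
consIso (ℓ , v) {ls'} {ls} I = record
  { to = λ { (u , x) → u , I.to x } ; from = λ { (u , x) → u , I.from x }
  ; to-from = λ { (u , x) → cong (u ,_) (I.to-from x) }
  ; from-to = λ { (u , x) → cong (u ,_) (I.from-to x) }
  ; height-to = λ { (u , x) → cong (toℕ u +_) (I.height-to x) }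
  ; topHeight-≡ = cong ((ℓ ∸ 1) +_) I.topHeight-≡
  ; to-covers = to-covers ; to-separated = to-separated }
  where
  module I = GridIso I
  to-covers : ∀ x y → Covers ((ℓ , v) ∷ ls') x y →
              Covers ((ℓ , v) ∷ ls) (proj₁ x , I.to (proj₂ x)) (proj₁ y , I.to (proj₂ y))
  to-covers (u , x) (u' , y) (inj₁ (u⋖u' , refl)) = inj₁ (u⋖u' , refl)
  to-covers (u , x) (u' , y) (inj₂ (refl , x⋖y))  = inj₂ (refl , I.to-covers x y x⋖y)
  to-separated : ∀ x y → Separated ((ℓ , v) ∷ ls') x y →
                 Separated ((ℓ , v) ∷ ls) (proj₁ x , I.to (proj₂ x)) (proj₁ y , I.to (proj₂ y))
  to-separated (u , x) (u' , y) (inj₁ d) = inj₁ d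
  to-separated (u , x) (u' , y) (inj₂ d) = inj₂ (I.to-separated x y d)

swapIso : ∀ S T ls → GridIso (S ∷ T ∷ ls) (T ∷ S ∷ ls)
swapIso (ℓ , v) (m , w) ls = record
  { to = λ { (u , u' , x) → u' , u , x } ; from = λ { (u' , u , x) → u , u' , x }
  ; to-from = λ _ → refl ; from-to = λ _ → refl
  ; height-to = λ { (u , u' , x) → x∙yz≈y∙xz (toℕ u') (toℕ u) (height ls x) }
  ; topHeight-≡ = x∙yz≈y∙xz (ℓ ∸ 1) (m ∸ 1) (topHeight ls)
  ; to-covers = to-covers ; to-separated = to-separated }
  where
  to-covers : ∀ x y → Covers ((ℓ , v) ∷ (m , w) ∷ ls) x y →
              Covers ((m , w) ∷ (ℓ , v) ∷ ls) (proj₁ (proj₂ x) , proj₁ x , proj₂ (proj₂ x))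
                                             (proj₁ (proj₂ y) , proj₁ y , proj₂ (proj₂ y))
  to-covers (u , u' , x) (_ , _ , _) (inj₁ (u⋖ , refl))              = inj₂ (refl , inj₁ (u⋖ , refl))
  to-covers (u , u' , x) (_ , _ , _) (inj₂ (refl , inj₁ (u'⋖ , refl))) = inj₁ (u'⋖ , refl)
  to-covers (u , u' , x) (_ , _ , _) (inj₂ (refl , inj₂ (refl , x⋖)))  = inj₂ (refl , inj₂ (refl , x⋖))
  to-separated : ∀ x y → Separated ((ℓ , v) ∷ (m , w) ∷ ls) x y →
                 Separated ((m , w) ∷ (ℓ , v) ∷ ls) (proj₁ (proj₂ x) , proj₁ x , proj₂ (proj₂ x))
                                                   (proj₁ (proj₂ y) , proj₁ y , proj₂ (proj₂ y))
  to-separated _ _ (inj₁ d)        = inj₂ (inj₁ d)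
  to-separated _ _ (inj₂ (inj₁ d)) = inj₁ d
  to-separated _ _ (inj₂ (inj₂ d)) = inj₂ (inj₂ d)

moveToFront : ∀ pre S post → GridIso (S ∷ pre ++ post) (pre ++ S ∷ post)
moveToFront []        S post = idIso (S ∷ post)
moveToFront (T ∷ pre) S post = consIso T (moveToFront pre S post) ∘Iso swapIso S T (pre ++ post)

-- Chains in a rectangle

StepsUp : ℕ × ℕ → ℕ × ℕ → Set
StepsUp (x , y) (x' , y') = (x' ≡ suc x × y' ≡ y) ⊎ (x' ≡ x × y' ≡ suc y)

record RectangleChain (a b : ℕ) (v : Bool) (L shift : ℕ) : Set where
  field
    point        : ℕ → ℕ × ℕ
    col-bound    : ∀ k → k < L → proj₁ (point k) ≤ a
    row-bound    : ∀ k → k < L → proj₂ (point k) ≤ b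
    steps        : ∀ k → suc k < L → StepsUp (point k) (point (suc k))
    height-point : ∀ k → k < L → proj₁ (point k) + proj₂ (point k) ≡ shift + k
    sameColumn   : ∀ k k' → k < L → k' < L → proj₁ (point k) ≡ proj₁ (point k') →
                   NotEndPair (suc b) v (proj₂ (point k)) (proj₂ (point k'))
    centred      : 0 < L → shift + shift + (L ∸ 1) ≡ a + b

module _ {L m : ℕ} (f : ℕ → ℕ) (bound : ∀ k → k < L → f k ≤ m) where

  toFin : Fin L → Fin (suc m)
  toFin k = fromℕ< (s≤s (bound (toℕ k) (toℕ<n k)))

  toℕ-toFin : ∀ k → toℕ (toFin k) ≡ f (toℕ k)
  toℕ-toFin k = toℕ-fromℕ< _

  toFin-injective : ∀ k k' → toFin k ≡ toFin k' → f (toℕ k) ≡ f (toℕ k')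
  toFin-injective k k' eq = trans (sym (toℕ-toFin k)) (trans (cong toℕ eq) (toℕ-toFin k'))

  toFin-cong : ∀ k k' → f (toℕ k) ≡ f (toℕ k') → toFin k ≡ toFin k'
  toFin-cong k k' eq = toℕ-injective (trans (toℕ-toFin k) (trans eq (sym (toℕ-toFin k'))))

  toFin-suc : ∀ k k' → f (toℕ k') ≡ suc (f (toℕ k)) → toℕ (toFin k') ≡ suc (toℕ (toFin k))
  toFin-suc k k' eq = trans (toℕ-toFin k') (trans eq (cong suc (sym (toℕ-toFin k))))

module RectangleChainEmbedding {a b v L shift} (c : RectangleChain a b v L shift) (R : List Side) where
  open RectangleChain c

  col row : ℕ → ℕ
  col k = proj₁ (point k)
  row k = proj₂ (point k)

  place : Point ((L , true) ∷ R) → Point ((suc a , true) ∷ (suc b , v) ∷ R)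
  place (k , x) = toFin col col-bound k , toFin row row-bound k , x

  point-injective : ∀ (k k' : Fin L) → col (toℕ k) ≡ col (toℕ k') → row (toℕ k) ≡ row (toℕ k') → k ≡ k'
  point-injective k k' col≡ row≡ = toℕ-injective (+-cancelˡ-≡ shift _ _ (begin
    shift + toℕ k                ≡⟨ height-point _ (toℕ<n k) ⟨
    col (toℕ k) + row (toℕ k)     ≡⟨ cong₂ _+_ col≡ row≡ ⟩
    col (toℕ k') + row (toℕ k')   ≡⟨ height-point _ (toℕ<n k') ⟩
    shift + toℕ k'               ∎))
    where open ≡-Reasoning

  place-covers : ∀ x y → Covers ((L , true) ∷ R) x y → Covers ((suc a , true) ∷ (suc b , v) ∷ R) (place x) (place y)
  place-covers (k , x) (k' , y) (inj₂ (refl , x⋖y)) = inj₂ (refl , inj₂ (refl , x⋖y))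
  place-covers (k , x) (k' , _) (inj₁ (k⋖k' , refl))
    with steps (toℕ k) (subst (_< L) k⋖k' (toℕ<n k'))
  ... | inj₁ (col⋖ , row≡) = inj₁ (toFin-suc col col-bound k k' (trans (cong col k⋖k') col⋖) ,
          cong (_, x) (toFin-cong row row-bound k k' (sym (trans (cong row k⋖k') row≡))))
  ... | inj₂ (col≡ , row⋖) = inj₂ (toFin-cong col col-bound k k' (sym (trans (cong col k⋖k') col≡)) ,
          inj₁ (toFin-suc row row-bound k k' (trans (cong row k⋖k') row⋖) , refl))

  place-separated : ∀ x y → Separated ((L , true) ∷ R) x y →
                    Separated ((suc a , true) ∷ (suc b , v) ∷ R) (place x) (place y)
  place-separated (k , x) (k' , y) (inj₂ d) = inj₂ (inj₂ d)
  place-separated (k , x) (k' , y) (inj₁ (k≢k' , _)) with col (toℕ k) ≟ col (toℕ k')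
  ... | no col≢ = inj₁ ((λ eq → col≢ (toFin-injective col col-bound k k' eq)) , tt)
  ... | yes col≡ = inj₂ (inj₁ ((λ eq → k≢k' (point-injective k k' col≡ (toFin-injective row row-bound k k' eq))) ,
          subst₂ (NotEndPair (suc b) v) (sym (toℕ-toFin row row-bound k)) (sym (toℕ-toFin row row-bound k'))
                 (sameColumn _ _ (toℕ<n k) (toℕ<n k') col≡)))

  place-injective : ∀ x y → place x ≡ place y → x ≡ y
  place-injective (k , x) (k' , y) eq = cong₂ _,_
    (point-injective k k' (toFin-injective col col-bound k k' (cong proj₁ eq))
                          (toFin-injective row row-bound k k' (cong (λ z → proj₁ (proj₂ z)) eq)))
    (cong (λ z → proj₂ (proj₂ z)) eq)

  height-place : ∀ x → height ((suc a , true) ∷ (suc b , v) ∷ R) (place x) ≡ shift + height ((L , true) ∷ R) x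
  height-place (k , x) = begin
    toℕ (toFin col col-bound k) + (toℕ (toFin row row-bound k) + height R x)
      ≡⟨ cong₂ (λ c r → c + (r + height R x)) (toℕ-toFin col col-bound k) (toℕ-toFin row row-bound k) ⟩
    col (toℕ k) + (row (toℕ k) + height R x)     ≡⟨ +-assoc (col (toℕ k)) _ _ ⟨
    (col (toℕ k) + row (toℕ k)) + height R x     ≡⟨ cong (_+ height R x) (height-point _ (toℕ<n k)) ⟩
    (shift + toℕ k) + height R x                 ≡⟨ +-assoc shift _ _ ⟩
    shift + (toℕ k + height R x)                 ∎
    where open ≡-Reasoning

  embedding : GridEmbedding ((L , true) ∷ R) ((suc a , true) ∷ (suc b , v) ∷ R)
  embedding = record
    { map = place ; shift = shift ; height-map = height-place ; centred = centred′
    ; map-covers = place-covers ; map-separated = place-separated ; map-injective = place-injective }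
    where
    centred′ : Point ((L , true) ∷ R) →
               shift + shift + topHeight ((L , true) ∷ R) ≡ topHeight ((suc a , true) ∷ (suc b , v) ∷ R)
    centred′ (k , _) = trans (sym (+-assoc (shift + shift) _ _))
      (trans (cong (_+ topHeight R) (centred (≤-<-trans z≤n (toℕ<n k)))) (+-assoc a b _))

  image : ∀ k (k<L : k < L) (u : Fin (suc a)) (y : Fin (suc b)) x →
          col k ≡ toℕ u → row k ≡ toℕ y → ImageOf embedding (u , y , x)
  image k k<L u y x col≡ row≡ = (fromℕ< k<L , x) , cong₂ _,_
    (toℕ-injective (trans (toℕ-toFin col col-bound (fromℕ< k<L)) (trans (cong col (toℕ-fromℕ< k<L)) col≡)))
    (cong₂ _,_ (toℕ-injective (trans (toℕ-toFin row row-bound (fromℕ< k<L)) (trans (cong row (toℕ-fromℕ< k<L)) row≡))) refl)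

  image-col : ∀ x {z} → place x ≡ z → col (toℕ (proj₁ x)) ≡ toℕ (proj₁ z)
  image-col (k , _) refl = sym (toℕ-toFin col col-bound k)

  image-row : ∀ x {z} → place x ≡ z → row (toℕ (proj₁ x)) ≡ toℕ (proj₁ (proj₂ z))
  image-row (k , _) refl = sym (toℕ-toFin row row-bound k)

-- Two very proper sides

-- Up column 0 to row b, then right along row b.
hook : ℕ → ℕ → ℕ × ℕ
hook zero    k       = k , 0
hook (suc b) zero    = 0 , 0
hook (suc b) (suc k) = proj₁ (hook b k) , suc (proj₂ (hook b k))

hookCol hookRow : ℕ → ℕ → ℕ
hookCol b k = proj₁ (hook b k)
hookRow b k = proj₂ (hook b k)

hook-height : ∀ b k → hookCol b k + hookRow b k ≡ k
hook-height zero    k       = +-identityʳ k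
hook-height (suc b) zero    = refl
hook-height (suc b) (suc k) = trans (+-suc (hookCol b k) (hookRow b k)) (cong suc (hook-height b k))

hook-column₀ : ∀ b k → k ≤ b → hook b k ≡ (0 , k)
hook-column₀ zero    zero    _         = refl
hook-column₀ (suc b) zero    _         = refl
hook-column₀ (suc b) (suc k) (s≤s k≤b) = cong (λ p → proj₁ p , suc (proj₂ p)) (hook-column₀ b k k≤b)

hook-row : ∀ b x → hook b (x + b) ≡ (x , b)
hook-row zero    x       = cong (_, 0) (+-identityʳ x)
hook-row (suc b) zero    = cong (λ p → proj₁ p , suc (proj₂ p)) (hook-column₀ b b ≤-refl)
hook-row (suc b) (suc x) = trans (cong (hook (suc b)) (+-suc (suc x) b))
                                 (cong (λ p → proj₁ p , suc (proj₂ p)) (hook-row b (suc x)))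

hook-steps : ∀ b k → StepsUp (hook b k) (hook b (suc k))
hook-steps zero    k       = inj₁ (refl , refl)
hook-steps (suc b) zero    rewrite hook-column₀ b 0 z≤n = inj₂ (refl , refl)
hook-steps (suc b) (suc k) with hook-steps b k
... | inj₁ (col⋖ , row≡) = inj₁ (col⋖ , cong suc row≡)
... | inj₂ (col≡ , row⋖) = inj₂ (col≡ , cong suc row⋖)

hookRow≤ : ∀ b k → hookRow b k ≤ b
hookRow≤ zero    k       = z≤n
hookRow≤ (suc b) zero    = z≤n
hookRow≤ (suc b) (suc k) = s≤s (hookRow≤ b k)

hook-onBorder : ∀ b k → hookCol b k ≡ 0 ⊎ hookRow b k ≡ b
hook-onBorder zero    k       = inj₂ refl
hook-onBorder (suc b) zero    = inj₁ refl
hook-onBorder (suc b) (suc k) with hook-onBorder b k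
... | inj₁ col≡0 = inj₁ col≡0
... | inj₂ row≡b = inj₂ (cong suc row≡b)

hookCol≤ : ∀ a b k → k ≤ a + b → hookCol b k ≤ a
hookCol≤ a b k k≤a+b with hook-onBorder b k
... | inj₁ col≡0 rewrite col≡0 = z≤n
... | inj₂ row≡b = +-cancelʳ-≤ b (hookCol b k) a (begin
  hookCol b k + b               ≡⟨ cong (hookCol b k +_) row≡b ⟨
  hookCol b k + hookRow b k     ≡⟨ hook-height b k ⟩
  k                             ≤⟨ k≤a+b ⟩
  a + b                         ∎)
  where open ≤-Reasoning

hookChain : ∀ a b → RectangleChain a b true (suc (a + b)) 0
hookChain a b = record
  { point        = hook b
  ; col-bound    = λ k k<L → hookCol≤ a b k (s≤s⁻¹ k<L)
  ; row-bound    = λ k _ → hookRow≤ b k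
  ; steps        = λ k _ → hook-steps b k
  ; height-point = λ k _ → hook-height b k
  ; sameColumn   = λ _ _ _ _ _ → tt
  ; centred      = λ _ → refl
  }

notEndPair-belowTop : ∀ ℓ v u u' → suc u < ℓ → suc u' < ℓ → NotEndPair ℓ v u u'
notEndPair-belowTop ℓ true  u u' _    _     = tt
notEndPair-belowTop ℓ false u u' u<ℓ u'<ℓ = inj₁ (u<ℓ , u'<ℓ)

inject₁-< : ∀ {m} (y : Fin m) → suc (toℕ (inject₁ y)) < suc m
inject₁-< y = s≤s (subst (_< _) (sym (toℕ-inject₁ y)) (toℕ<n y))

shiftedRectangle : ∀ a b v R → GridEmbedding ((a , true) ∷ (b , true) ∷ R) ((suc a , true) ∷ (suc b , v) ∷ R)
shiftedRectangle a b v R = record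
  { map = shift ; shift = 1 ; height-map = height-shift ; centred = centred
  ; map-covers = shift-covers ; map-separated = shift-separated ; map-injective = shift-injective }
  where
  small = (a , true) ∷ (b , true) ∷ R
  large = (suc a , true) ∷ (suc b , v) ∷ R
  shift : Point small → Point large
  shift (x , y , r) = suc x , inject₁ y , r
  height-shift : ∀ p → height large (shift p) ≡ 1 + height small p
  height-shift (x , y , r) = cong (λ h → suc (toℕ x + (h + height R r))) (toℕ-inject₁ y)
  centred : Point small → 1 + 1 + topHeight small ≡ topHeight large
  centred (x , y , _) = inhabited-centred x y
    where
    inhabited-centred : ∀ {a b} → Fin a → Fin b → 1 + 1 + ((a ∸ 1) + ((b ∸ 1) + topHeight R)) ≡ a + (b + topHeight R)
    inhabited-centred {suc a'} {suc b'} _ _ = cong suc (sym (+-suc a' (b' + topHeight R)))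
  shift-covers : ∀ p q → Covers small p q → Covers large (shift p) (shift q)
  shift-covers (x , y , r) (x' , _ , _) (inj₁ (x⋖x' , refl)) = inj₁ (cong suc x⋖x' , refl)
  shift-covers (x , y , r) (_ , y' , _) (inj₂ (refl , inj₁ (y⋖y' , refl))) =
    inj₂ (refl , inj₁ (trans (toℕ-inject₁ y') (trans y⋖y' (cong suc (sym (toℕ-inject₁ y)))) , refl))
  shift-covers (x , y , r) (_ , _ , r') (inj₂ (refl , inj₂ (refl , r⋖r'))) = inj₂ (refl , inj₂ (refl , r⋖r'))
  shift-separated : ∀ p q → Separated small p q → Separated large (shift p) (shift q)
  shift-separated (x , y , r) (x' , y' , r') (inj₁ (x≢x' , _)) = inj₁ ((λ eq → x≢x' (Fin.suc-injective eq)) , tt)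
  shift-separated (x , y , r) (x' , y' , r') (inj₂ (inj₁ (y≢y' , _))) =
    inj₂ (inj₁ ((λ eq → y≢y' (inject₁-injective eq)) , notEndPair-belowTop (suc b) v _ _ (inject₁-< y) (inject₁-< y')))
  shift-separated (x , y , r) (x' , y' , r') (inj₂ (inj₂ d)) = inj₂ (inj₂ d)
  shift-injective : ∀ p q → shift p ≡ shift q → p ≡ q
  shift-injective (x , y , r) (x' , y' , r') eq = cong₂ _,_ (Fin.suc-injective (cong proj₁ eq))
    (cong₂ _,_ (inject₁-injective (cong (λ z → proj₁ (proj₂ z)) eq)) (cong (λ z → proj₂ (proj₂ z)) eq))

hookDecomposition : ∀ a b R → Decomposition ((suc (a + b) , true) ∷ R) → Decomposition ((a , true) ∷ (b , true) ∷ R) →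
                    Decomposition ((suc a , true) ∷ (suc b , true) ∷ R)
hookDecomposition a b R = glue₂ Hook.embedding Rest disjoint onto
  where
  module Hook = RectangleChainEmbedding (hookChain a b) R
  Rest = shiftedRectangle a b true R
  disjoint : DisjointImages Hook.embedding Rest
  disjoint (k , r) (x , y , r') eq with hook-onBorder b (toℕ k)
  ... | inj₁ col≡0 = 0≢1+n (trans (sym col≡0) (Hook.image-col (k , r) eq))
  ... | inj₂ row≡b = <⇒≢ (toℕ<n y) (sym (begin
    b                        ≡⟨ row≡b ⟨
    hookRow b (toℕ k)        ≡⟨ Hook.image-row (k , r) eq ⟩
    toℕ (inject₁ y)          ≡⟨ toℕ-inject₁ y ⟩
    toℕ y                    ∎))
    where open ≡-Reasoning
  onto : ∀ z → ImageOf Hook.embedding z ⊎ ImageOf Rest z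
  onto (zero , y , r) = inj₁ (Hook.image (toℕ y) (s≤s (≤-trans y≤b (m≤n+m b a))) zero y r
                                 (cong proj₁ column₀) (cong proj₂ column₀))
    where y≤b = s≤s⁻¹ (toℕ<n y)
          column₀ = hook-column₀ b (toℕ y) y≤b
  onto (suc x , y , r) with toℕ y ≟ b
  ... | yes y≡b = inj₁ (Hook.image (toℕ (suc x) + b) (s≤s (+-monoˡ-≤ b (s≤s⁻¹ (toℕ<n (suc x))))) (suc x) y r
                                   (cong proj₁ onRow) (trans (cong proj₂ onRow) (sym y≡b)))
    where onRow = hook-row b (toℕ (suc x))
  ... | no y≢b = inj₂ ((x , fromℕ< y<b , r) , cong (λ w → suc x , w , r)
                        (toℕ-injective (trans (toℕ-inject₁ _) (toℕ-fromℕ< y<b))))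
    where y<b = ≤∧≢⇒< (s≤s⁻¹ (toℕ<n y)) y≢b

-- A merely proper side

cornerSum : ∀ p q → (2 + p) + (2 + q) ≡ 4 + (p + q)
cornerSum = solve-∀

innerCentred : ∀ p q t → 2 + 2 + (q + (p + t)) ≡ (2 + p) + ((2 + q) + t)
innerCentred = solve-∀

innerHeight : ∀ x y t → 2 + x + (y + t) ≡ 2 + (y + (x + t))
innerHeight = solve-∀

-- Inside [p+3] × [q+3]: the long chain runs from (0,0) up column 1 to row q+1, along that row to
-- column p+2 and on to (p+2,q+2); the short chain runs from (0,1) up column 0 and along row q+2;
-- what is left is [2,p+2] × [0,q].
module ProperSideSplit (p q : ℕ) where

  N : ℕ
  N = 3 + p + q

  longPoint : ℕ → ℕ × ℕ
  longPoint zero = 0 , 0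
  longPoint (suc k) with k ≟ N
  ... | yes _ = 2 + p , 2 + q
  ... | no  _ = suc (hookCol (suc q) k) , hookRow (suc q) k

  longPoint-hook : ∀ k → k ≢ N → longPoint (suc k) ≡ (suc (hookCol (suc q) k) , hookRow (suc q) k)
  longPoint-hook k k≢N with k ≟ N
  ... | yes k≡N = ⊥-elim (k≢N k≡N)
  ... | no  _   = refl

  longPoint-top : longPoint (suc N) ≡ (2 + p , 2 + q)
  longPoint-top with N ≟ N
  ... | yes _   = refl
  ... | no  N≢N = ⊥-elim (N≢N refl)

  shortPoint : ℕ → ℕ × ℕ
  shortPoint k = hookCol (suc q) k , suc (hookRow (suc q) k)

  N-split : N ≡ suc (suc p + suc q)
  N-split = cong (λ n → suc (suc n)) (sym (+-suc p q))

  innerHookCol≤ : ∀ k → k < N → hookCol (suc q) k ≤ suc p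
  innerHookCol≤ k k<N = hookCol≤ (suc p) (suc q) k (s≤s⁻¹ (subst (k <_) N-split k<N))

  record LongShape (x y : ℕ) : Set where
    field
      col≤   : x ≤ 2 + p
      row≤   : y ≤ 2 + q
      col₀   : x ≡ 0 → y ≡ 0
      col₁   : x ≡ 1 → y ≤ 1 + q
      col₂   : 2 ≤ x → 1 + q ≤ y
      rowTop : y ≡ 2 + q → x ≡ 2 + p

  innerHookShape : ∀ k → k < N → LongShape (suc (hookCol (suc q) k)) (hookRow (suc q) k)
  innerHookShape k k<N = record
    { col≤   = s≤s (innerHookCol≤ k k<N)
    ; row≤   = ≤-trans (hookRow≤ (suc q) k) (n≤1+n _)
    ; col₀   = λ ()
    ; col₁   = λ _ → hookRow≤ (suc q) k
    ; col₂   = col₂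
    ; rowTop = λ row≡ → ⊥-elim (1+n≰n (≤-trans (≤-reflexive (sym row≡)) (hookRow≤ (suc q) k)))
    }
    where
    col₂ : 2 ≤ suc (hookCol (suc q) k) → 1 + q ≤ hookRow (suc q) k
    col₂ (s≤s 1≤col) with hook-onBorder (suc q) k
    ... | inj₁ col≡0 = ⊥-elim (<⇒≢ 1≤col (sym col≡0))
    ... | inj₂ row≡  = ≤-reflexive (sym row≡)

  longShape : ∀ k → k ≤ suc N → LongShape (proj₁ (longPoint k)) (proj₂ (longPoint k))
  longShape zero _ = record
    { col≤ = z≤n ; row≤ = z≤n ; col₀ = λ _ → refl ; col₁ = λ () ; col₂ = λ () ; rowTop = λ () }
  longShape (suc k) (s≤s k≤N) with k ≟ N
  ... | yes _   = record
    { col≤ = ≤-refl ; row≤ = ≤-refl ; col₀ = λ () ; col₁ = λ () ; col₂ = λ _ → n≤1+n _ ; rowTop = λ _ → refl }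
  ... | no k≢N = innerHookShape k (≤∧≢⇒< k≤N k≢N)

  long-height : ∀ k → proj₁ (longPoint k) + proj₂ (longPoint k) ≡ k
  long-height zero = refl
  long-height (suc k) with k ≟ N
  ... | yes refl = cornerSum p q
  ... | no  _    = cong suc (hook-height (suc q) k)

  long-steps : ∀ k → k < suc N → StepsUp (longPoint k) (longPoint (suc k))
  long-steps zero _ rewrite longPoint-hook 0 (λ ()) | hook-column₀ (suc q) 0 z≤n = inj₁ (refl , refl)
  long-steps (suc k) (s≤s k<N) with suc k ≟ N
  ... | yes k+1≡N rewrite longPoint-hook k (<⇒≢ k<N) =
        inj₂ (cong suc (sym (cong proj₁ cornerHook)) , cong suc (sym (cong proj₂ cornerHook)))
    where
    cornerHook : hook (suc q) k ≡ (suc p , suc q)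
    cornerHook = trans (cong (hook (suc q)) (suc-injective (trans k+1≡N N-split))) (hook-row (suc q) (suc p))
  ... | no _ rewrite longPoint-hook k (<⇒≢ k<N) with hook-steps (suc q) k
  ...   | inj₁ (col⋖ , row≡) = inj₁ (cong suc col⋖ , row≡)
  ...   | inj₂ (col≡ , row⋖) = inj₂ (cong suc col≡ , row⋖)

  record ShortShape (x y : ℕ) : Set where
    field
      col≤   : x ≤ suc p
      row≤   : y ≤ 2 + q
      row≥1  : 1 ≤ y
      border : x ≡ 0 ⊎ y ≡ 2 + q

  shortShape : ∀ k → k < N → ShortShape (proj₁ (shortPoint k)) (proj₂ (shortPoint k))
  shortShape k k<N = record
    { col≤   = innerHookCol≤ k k<N
    ; row≤   = s≤s (hookRow≤ (suc q) k)
    ; row≥1  = s≤s z≤n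
    ; border = Sum.map₂ (cong suc) (hook-onBorder (suc q) k)
    }

  short-steps : ∀ k → StepsUp (shortPoint k) (shortPoint (suc k))
  short-steps k with hook-steps (suc q) k
  ... | inj₁ (col⋖ , row≡) = inj₁ (col⋖ , cong suc row≡)
  ... | inj₂ (col≡ , row⋖) = inj₂ (col≡ , cong suc row⋖)

  lowRows-notEndPair : ∀ x y x' y' → LongShape x y → LongShape x' y' → x ≡ x' → x ≤ 1 →
                       NotEndPair (3 + q) false y y'
  lowRows-notEndPair x y x' y' S S' refl x≤1 = inj₁ (lowRow x y S x≤1 , lowRow x y' S' x≤1)
    where
    lowRow : ∀ x y → LongShape x y → x ≤ 1 → suc y < 3 + q
    lowRow zero          y S _ rewrite LongShape.col₀ S refl = s≤s (s≤s z≤n)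
    lowRow (suc zero)    y S _ = s≤s (s≤s (LongShape.col₁ S refl))
    lowRow (suc (suc x)) y S (s≤s ())

  longChain : RectangleChain (2 + p) (2 + q) false (2 + N) 0
  longChain = record
    { point        = longPoint
    ; col-bound    = λ k k<L → LongShape.col≤ (longShape k (s≤s⁻¹ k<L))
    ; row-bound    = λ k k<L → LongShape.row≤ (longShape k (s≤s⁻¹ k<L))
    ; steps        = λ k k+1<L → long-steps k (s≤s⁻¹ k+1<L)
    ; height-point = λ k _ → long-height k
    ; sameColumn   = sameColumn
    ; centred      = λ _ → sym (cornerSum p q)
    }
    where
    sameColumn : ∀ k k' → k < 2 + N → k' < 2 + N → proj₁ (longPoint k) ≡ proj₁ (longPoint k') →
                 NotEndPair (3 + q) false (proj₂ (longPoint k)) (proj₂ (longPoint k'))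
    sameColumn k k' k<L k'<L col≡ with proj₁ (longPoint k) ≤? 1
    ... | yes x≤1 = lowRows-notEndPair _ _ _ _ S S' col≡ x≤1
      where S  = longShape k (s≤s⁻¹ k<L)
            S' = longShape k' (s≤s⁻¹ k'<L)
    ... | no x≰1 = inj₂ (≤-trans (s≤s z≤n) (LongShape.col₂ S (≰⇒> x≰1)) ,
                         ≤-trans (s≤s z≤n) (LongShape.col₂ S' (subst (2 ≤_) col≡ (≰⇒> x≰1))))
      where S  = longShape k (s≤s⁻¹ k<L)
            S' = longShape k' (s≤s⁻¹ k'<L)

  shortChain : RectangleChain (2 + p) (2 + q) false N 1
  shortChain = record
    { point        = shortPoint
    ; col-bound    = λ k k<N → ≤-trans (ShortShape.col≤ (shortShape k k<N)) (n≤1+n _)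
    ; row-bound    = λ k k<N → ShortShape.row≤ (shortShape k k<N)
    ; steps        = λ k _ → short-steps k
    ; height-point = λ k _ → trans (+-suc _ _) (cong suc (hook-height (suc q) k))
    ; sameColumn   = λ k k' k<N k'<N _ → inj₂ (ShortShape.row≥1 (shortShape k k<N) , ShortShape.row≥1 (shortShape k' k'<N))
    ; centred      = λ _ → sym (cornerSum p q)
    }

  data Location (x y : ℕ) : Set where
    onLong  : ∀ k → k ≤ suc N → longPoint k ≡ (x , y) → Location x y
    onShort : ∀ k → k < N → shortPoint k ≡ (x , y) → Location x y
    inner   : ∀ x' → x' ≤ p → y ≤ q → x ≡ 2 + x' → Location x y

  q+1<N : suc q < N
  q+1<N = s≤s (s≤s (≤-trans (m≤n+m q p) (n≤1+n _)))

  locate : ∀ x y → x ≤ 2 + p → y ≤ 2 + q → Location x y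
  locate zero zero _ _ = onLong 0 z≤n refl
  locate zero (suc y) _ (s≤s y≤q+1) =
    onShort y (≤-<-trans y≤q+1 q+1<N) (cong (λ h → proj₁ h , suc (proj₂ h)) (hook-column₀ (suc q) y y≤q+1))
  locate (suc zero) y _ y≤q+2 with y ≤? suc q
  ... | yes y≤q+1 = onLong (suc y) (s≤s (<⇒≤ y<N))
          (trans (longPoint-hook y (<⇒≢ y<N)) (cong (λ h → suc (proj₁ h) , proj₂ h) (hook-column₀ (suc q) y y≤q+1)))
    where y<N = ≤-<-trans y≤q+1 q+1<N
  ... | no y≰q+1 rewrite ≤-antisym y≤q+2 (≰⇒> y≰q+1) =
          onShort (1 + suc q) (s≤s (s≤s (s≤s (m≤n+m q p))))
                  (cong (λ h → proj₁ h , suc (proj₂ h)) (hook-row (suc q) 1))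
  locate (suc (suc x)) y (s≤s (s≤s x≤p)) y≤q+2 with y ≤? q
  ... | yes y≤q = inner x x≤p y≤q refl
  ... | no y≰q with y ≟ suc q
  ...   | yes refl = onLong (suc (suc x + suc q)) (s≤s (<⇒≤ k<N))
            (trans (longPoint-hook _ (<⇒≢ k<N)) (cong (λ h → suc (proj₁ h) , proj₂ h) (hook-row (suc q) (suc x))))
    where k<N : suc x + suc q < N
          k<N = s≤s (≤-trans (+-monoˡ-≤ (suc q) (s≤s x≤p)) (≤-reflexive (cong suc (+-suc p q))))
  ...   | no y≢q+1 with ≤-antisym y≤q+2 (≤∧≢⇒< (≰⇒> y≰q) (λ eq → y≢q+1 (sym eq)))
  ...     | refl with x ≟ p
  ...       | yes refl = onLong (suc N) ≤-refl longPoint-top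
  ...       | no x≢p = onShort (suc (suc x) + suc q)
                (s≤s (s≤s (s≤s (≤-trans (≤-reflexive (+-suc x q)) (+-monoˡ-≤ q (≤∧≢⇒< x≤p x≢p))))))
                (cong (λ h → proj₁ h , suc (proj₂ h)) (hook-row (suc q) (suc (suc x))))

  inject₂ : Fin (suc q) → Fin (3 + q)
  inject₂ y = inject₁ (inject₁ y)

  toℕ-inject₂ : ∀ y → toℕ (inject₂ y) ≡ toℕ y
  toℕ-inject₂ y = trans (toℕ-inject₁ (inject₁ y)) (toℕ-inject₁ y)

  inject₂-< : ∀ y → suc (toℕ (inject₂ y)) < 3 + q
  inject₂-< y = s≤s (subst (_< 2 + q) (sym (toℕ-inject₂ y)) (≤-trans (toℕ<n y) (n≤1+n _)))

  innerRectangle : ∀ R → GridEmbedding ((suc q , true) ∷ (suc p , true) ∷ R) ((3 + p , true) ∷ (3 + q , false) ∷ R)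
  innerRectangle R = record
    { map = place ; shift = 2
    ; height-map = λ { (y , x , r) → trans (cong (λ h → 2 + toℕ x + (h + height R r)) (toℕ-inject₂ y))
                                           (innerHeight (toℕ x) (toℕ y) (height R r)) }
    ; centred = λ _ → innerCentred p q (topHeight R)
    ; map-covers = place-covers ; map-separated = place-separated ; map-injective = place-injective }
    where
    place : Point ((suc q , true) ∷ (suc p , true) ∷ R) → Point ((3 + p , true) ∷ (3 + q , false) ∷ R)
    place (y , x , r) = suc (suc x) , inject₂ y , r
    place-covers : ∀ z w → Covers ((suc q , true) ∷ (suc p , true) ∷ R) z w →
                   Covers ((3 + p , true) ∷ (3 + q , false) ∷ R) (place z) (place w)
    place-covers (y , x , r) (y' , _ , _) (inj₁ (y⋖y' , refl)) =
      inj₂ (refl , inj₁ (trans (toℕ-inject₂ y') (trans y⋖y' (cong suc (sym (toℕ-inject₂ y)))) , refl))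
    place-covers (y , x , r) (_ , x' , _) (inj₂ (refl , inj₁ (x⋖x' , refl))) = inj₁ (cong (λ n → suc (suc n)) x⋖x' , refl)
    place-covers (y , x , r) (_ , _ , r') (inj₂ (refl , inj₂ (refl , r⋖r'))) = inj₂ (refl , inj₂ (refl , r⋖r'))
    place-separated : ∀ z w → Separated ((suc q , true) ∷ (suc p , true) ∷ R) z w →
                      Separated ((3 + p , true) ∷ (3 + q , false) ∷ R) (place z) (place w)
    place-separated (y , x , r) (y' , x' , r') (inj₁ (y≢y' , _)) =
      inj₂ (inj₁ ((λ eq → y≢y' (inject₁-injective (inject₁-injective eq))) ,
                  notEndPair-belowTop (3 + q) false _ _ (inject₂-< y) (inject₂-< y')))
    place-separated (y , x , r) (y' , x' , r') (inj₂ (inj₁ (x≢x' , _))) =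
      inj₁ ((λ eq → x≢x' (Fin.suc-injective (Fin.suc-injective eq))) , tt)
    place-separated (y , x , r) (y' , x' , r') (inj₂ (inj₂ d)) = inj₂ (inj₂ d)
    place-injective : ∀ z w → place z ≡ place w → z ≡ w
    place-injective (y , x , r) (y' , x' , r') eq =
      cong₂ _,_ (inject₁-injective (inject₁-injective (cong (λ z → proj₁ (proj₂ z)) eq)))
                (cong₂ _,_ (Fin.suc-injective (Fin.suc-injective (cong proj₁ eq))) (cong (λ z → proj₂ (proj₂ z)) eq))

  long-short-apart : ∀ {x y x' y'} → LongShape x y → ShortShape x' y' → x ≡ x' → y ≡ y' → ⊥
  long-short-apart L S refl refl with ShortShape.border S
  ... | inj₁ x≡0   = <⇒≢ (ShortShape.row≥1 S) (sym (LongShape.col₀ L x≡0))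
  ... | inj₂ y≡top = 1+n≰n (subst (_≤ suc p) (LongShape.rowTop L y≡top) (ShortShape.col≤ S))

  long-inner-apart : ∀ {x y} → LongShape x y → 2 ≤ x → y ≤ q → ⊥
  long-inner-apart L 2≤x y≤q = 1+n≰n (≤-trans (LongShape.col₂ L 2≤x) y≤q)

  short-inner-apart : ∀ {x y} → ShortShape x y → 2 ≤ x → y ≤ q → ⊥
  short-inner-apart S 2≤x y≤q with ShortShape.border S
  ... | inj₁ refl  = 1+n≰n (≤-trans (s≤s z≤n) 2≤x)
  ... | inj₂ refl  = 1+n≰n (≤-trans (n≤1+n _) y≤q)

  properSideDecomposition : ∀ R → Decomposition ((2 + N , true) ∷ R) → Decomposition ((N , true) ∷ R) →
                            Decomposition ((suc q , true) ∷ (suc p , true) ∷ R) →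
                            Decomposition ((3 + p , true) ∷ (3 + q , false) ∷ R)
  properSideDecomposition R = glue₃ Long.embedding Short.embedding (innerRectangle R) long∩short long∩inner short∩inner onto
    where
    module Long  = RectangleChainEmbedding longChain R
    module Short = RectangleChainEmbedding shortChain R

    longShapeAt : (k : Fin (2 + N)) → LongShape (Long.col (toℕ k)) (Long.row (toℕ k))
    longShapeAt k = longShape (toℕ k) (s≤s⁻¹ (toℕ<n k))

    shortShapeAt : (k : Fin N) → ShortShape (Short.col (toℕ k)) (Short.row (toℕ k))
    shortShapeAt k = shortShape (toℕ k) (toℕ<n k)

    long∩short : DisjointImages Long.embedding Short.embedding
    long∩short x x' eq = long-short-apart (longShapeAt (proj₁ x)) (shortShapeAt (proj₁ x'))
      (trans (Long.image-col x eq) (sym (Short.image-col x' refl)))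
      (trans (Long.image-row x eq) (sym (Short.image-row x' refl)))

    long∩inner : DisjointImages Long.embedding (innerRectangle R)
    long∩inner x (y , _ , _) eq = long-inner-apart (longShapeAt (proj₁ x))
      (subst (2 ≤_) (sym (Long.image-col x eq)) (s≤s (s≤s z≤n)))
      (subst (_≤ q) (sym (trans (Long.image-row x eq) (toℕ-inject₂ y))) (s≤s⁻¹ (toℕ<n y)))

    short∩inner : DisjointImages Short.embedding (innerRectangle R)
    short∩inner x (y , _ , _) eq = short-inner-apart (shortShapeAt (proj₁ x))
      (subst (2 ≤_) (sym (Short.image-col x eq)) (s≤s (s≤s z≤n)))
      (subst (_≤ q) (sym (trans (Short.image-row x eq) (toℕ-inject₂ y))) (s≤s⁻¹ (toℕ<n y)))

    onto : ∀ z → ImageOf Long.embedding z ⊎ ImageOf Short.embedding z ⊎ ImageOf (innerRectangle R) z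
    onto (u , y , r) with locate (toℕ u) (toℕ y) (s≤s⁻¹ (toℕ<n u)) (s≤s⁻¹ (toℕ<n y))
    ... | onLong k k≤N+1 eq = inj₁ (Long.image k (s≤s k≤N+1) u y r (cong proj₁ eq) (cong proj₂ eq))
    ... | onShort k k<N eq = inj₂ (inj₁ (Short.image k k<N u y r (cong proj₁ eq) (cong proj₂ eq)))
    ... | inner x x≤p y≤q u≡ = inj₂ (inj₂ ((fromℕ< (s≤s y≤q) , fromℕ< (s≤s x≤p) , r) , cong₂ _,_
            (toℕ-injective (trans (cong (λ n → suc (suc n)) (toℕ-fromℕ< (s≤s x≤p))) (sym u≡)))
            (cong (_, r) (toℕ-injective (trans (toℕ-inject₂ _) (toℕ-fromℕ< (s≤s y≤q)))))))

-- Decomposing a grid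

hookSize₁ : ∀ a b m → suc a + (suc b + m) ≡ (suc (a + b) + m) + 1
hookSize₁ = solve-∀

hookSize₂ : ∀ a b m → suc a + (suc b + m) ≡ (a + (b + m)) + 2
hookSize₂ = solve-∀

properSize₁ : ∀ p q m → (3 + p) + ((5 + q) + m) ≡ ((2 + (3 + p + (2 + q))) + m) + 1
properSize₁ = solve-∀

properSize₂ : ∀ p q m → (3 + p) + ((5 + q) + m) ≡ ((3 + p + (2 + q)) + m) + 3
properSize₂ = solve-∀

properSize₃ : ∀ p q m → (3 + p) + ((5 + q) + m) ≡ (suc (2 + q) + (suc p + m)) + 4
properSize₃ = solve-∀

VeryProperSide : Side → Set
VeryProperSide (_ , v) = v ≡ true

LongIfProper : Side → Set
LongIfProper (ℓ , v) = v ≡ false → 5 ≤ ℓ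

totalLength : List Side → ℕ
totalLength []             = 0
totalLength ((ℓ , _) ∷ ls) = ℓ + totalLength ls

totalLength-middle : ∀ pre S post → totalLength (pre ++ S ∷ post) ≡ proj₁ S + totalLength (pre ++ post)
totalLength-middle []              S post = refl
totalLength-middle ((ℓ , _) ∷ pre) S post =
  trans (cong (ℓ +_) (totalLength-middle pre S post)) (x∙yz≈y∙xz ℓ (proj₁ S) (totalLength (pre ++ post)))

data ProperSideView : List Side → Set where
  allVeryProper : ∀ {ls} → All VeryProperSide ls → ProperSideView ls
  properSide    : ∀ pre ℓ post → ProperSideView (pre ++ (ℓ , false) ∷ post)

properSideView : ∀ ls → ProperSideView ls
properSideView []                 = allVeryProper []
properSideView ((ℓ , false) ∷ ls) = properSide [] ℓ ls
properSideView ((ℓ , true)  ∷ ls) with properSideView ls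
... | allVeryProper allVP    = allVeryProper (refl ∷ allVP)
... | properSide pre ℓ' post = properSide ((ℓ , true) ∷ pre) ℓ' post

all-middle : ∀ {P : Side → Set} pre {S} post → All P (pre ++ S ∷ post) → P S × All P (pre ++ post)
all-middle pre post all with ++⁻ pre all
... | allPre , pS ∷ allPost = pS , ++⁺ allPre allPost

noProperSide : ∀ pre {ℓ} post → All VeryProperSide (pre ++ (ℓ , false) ∷ post) → ⊥
noProperSide pre post allVP with ++⁻ʳ pre allVP
... | () ∷ _

fuel-step : ∀ {parent fuel} child d → parent ≡ child + suc d → parent ≤ suc fuel → child ≤ fuel
fuel-step {fuel = fuel} child d eq size =
  ≤-trans (m≤m+n child d) (s≤s⁻¹ (subst (_≤ suc fuel) (trans eq (+-suc child d)) size))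

mutual
  decompose : ∀ fuel h ls → h + totalLength ls ≤ fuel → All LongIfProper ls →
              3 ≤ h ⊎ All VeryProperSide ls → Decomposition ((h , true) ∷ ls)
  decompose _          zero    _  _    _    _     = emptyDecomposition λ { (() , _) }
  decompose zero       (suc a) _  ()   _    _
  decompose (suc fuel) (suc a) ls size long first with properSideView ls
  ... | allVeryProper allVP = decomposeVeryProper fuel a ls size long allVP
  ... | properSide pre ℓ post = decomposeProper fuel pre post 3≤h (proj₁ long′ refl) size′ (proj₂ long′)
    where
    long′ = all-middle pre post long
    3≤h   = Sum.fromInj₁ (λ allVP → ⊥-elim (noProperSide pre post allVP)) first
    size′ = subst (λ t → suc a + t ≤ suc fuel) (totalLength-middle pre (ℓ , false) post) size

  decomposeVeryProper : ∀ fuel a ls → suc a + totalLength ls ≤ suc fuel → All LongIfProper ls →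
                        All VeryProperSide ls → Decomposition ((suc a , true) ∷ ls)
  decomposeVeryProper fuel a [] _ _ _ = lineDecomposition a
  decomposeVeryProper fuel a ((zero , _) ∷ ls) _ _ _ = emptyDecomposition λ { (_ , () , _) }
  decomposeVeryProper fuel a ((suc b , _) ∷ ls) size (_ ∷ long) (refl ∷ allVP) =
    hookDecomposition a b ls
      (decompose fuel (suc (a + b)) ls (fuel-step _ 0 (hookSize₁ a b m) size) long (inj₂ allVP))
      (decompose fuel a ((b , true) ∷ ls) (fuel-step _ 1 (hookSize₂ a b m) size) ((λ ()) ∷ long) (inj₂ (refl ∷ allVP)))
    where m = totalLength ls

  decomposeProper : ∀ fuel {h ℓ} pre post → 3 ≤ h → 5 ≤ ℓ → h + (ℓ + totalLength (pre ++ post)) ≤ suc fuel →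
                    All LongIfProper (pre ++ post) → Decomposition ((h , true) ∷ pre ++ (ℓ , false) ∷ post)
  decomposeProper fuel {suc (suc (suc p))} {suc (suc (suc (suc (suc q))))} pre post
                  (s≤s (s≤s (s≤s _))) (s≤s (s≤s (s≤s (s≤s (s≤s _))))) size long =
    glue₁ (GridIso.embedding toFront) (GridIso.onto toFront)
      (ProperSideSplit.properSideDecomposition p (2 + q) R
        (decompose fuel _ R (fuel-step _ 0 (properSize₁ p q m) size) long (inj₁ 3≤))
        (decompose fuel _ R (fuel-step _ 2 (properSize₂ p q m) size) long (inj₁ 3≤))
        (decompose fuel _ ((suc p , true) ∷ R) (fuel-step _ 3 (properSize₃ p q m) size) ((λ ()) ∷ long) (inj₁ 3≤)))
    where
    R = pre ++ post
    m = totalLength R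
    3≤ : ∀ {n} → 3 ≤ 3 + n
    3≤ = s≤s (s≤s (s≤s z≤n))
    toFront = consIso (3 + p , true) (moveToFront pre (5 + q , false) post)

-- Ranks in P

sumFin-cong : ∀ {m} {f g : Fin m → ℕ} → (∀ i → f i ≡ g i) → sumFin f ≡ sumFin g
sumFin-cong {zero}  f≡g = refl
sumFin-cong {suc m} f≡g = cong₂ _+_ (f≡g zero) (sumFin-cong (λ i → f≡g (suc i)))

sumFin-+ : ∀ {m} (f g : Fin m → ℕ) → sumFin (λ i → f i + g i) ≡ sumFin f + sumFin g
sumFin-+ {zero}  f g = refl
sumFin-+ {suc m} f g = trans (cong (f zero + g zero +_) (sumFin-+ (λ i → f (suc i)) (λ i → g (suc i))))
                             (interchange (f zero) (g zero) _ _)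

sumFin-mono : ∀ {m} {f g : Fin m → ℕ} → (∀ i → f i ≤ g i) → sumFin f ≤ sumFin g
sumFin-mono {zero}  f≤g = z≤n
sumFin-mono {suc m} f≤g = +-mono-≤ (f≤g zero) (sumFin-mono (λ i → f≤g (suc i)))

sumFin-zero : ∀ {m} {f : Fin m → ℕ} → (∀ i → f i ≡ 0) → sumFin f ≡ 0
sumFin-zero {zero}  f≡0 = refl
sumFin-zero {suc m} f≡0 = cong₂ _+_ (f≡0 zero) (sumFin-zero (λ i → f≡0 (suc i)))

module _ {s : ℕ} (n : Fin s → ℕ) (I : Subset s) where

  rank-min : ∀ a → IsMinI n I a → rank n I a ≡ 0
  rank-min a min = sumFin-zero term≡0
    where
    term≡0 : ∀ i → (if lookup I i then ∣ a i ∣ else 0) ≡ 0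
    term≡0 i with lookup I i in i∈I
    ... | true  = trans (cong ∣_∣ (min i (lookup⇒[]= i I i∈I))) (∣⊥∣≡0 (n i))
    ... | false = refl

  rank≤rank-max : ∀ a b → IsMaxI n I b → rank n I a ≤ rank n I b
  rank≤rank-max a b max = sumFin-mono term≤
    where
    term≤ : ∀ i → (if lookup I i then ∣ a i ∣ else 0) ≤ (if lookup I i then ∣ b i ∣ else 0)
    term≤ i with lookup I i in i∈I
    ... | true  = subst (∣ a i ∣ ≤_) (sym (trans (cong ∣_∣ (max i (lookup⇒[]= i I i∈I))) (∣⊤∣≡n (n i)))) (∣p∣≤n (a i))
    ... | false = z≤n

  module _ {r : ℕ} {c : Fin r → Elem n} (skips : SkipsNoRanks n I c) where

    min-atBottom : ∀ k → IsMinI n I (c k) → 0 < toℕ k → ⊥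
    min-atBottom k min 0<k with toℕ k in k≡ | toℕ<n k | 0<k
    ... | suc j | j+1<r | _ = 0≢1+n (trans (sym (rank-min (c k) min)) (proj₂ (skips (fromℕ< j<r) k k≡′)))
      where
      j<r = ≤-<-trans (n≤1+n j) j+1<r
      k≡′ = trans k≡ (cong suc (sym (toℕ-fromℕ< j<r)))

    max-atTop : ∀ k → IsMaxI n I (c k) → suc (toℕ k) < r → ⊥
    max-atTop k max k+1<r = 1+n≰n (subst (_≤ rank n I (c k)) (proj₂ (skips k (fromℕ< k+1<r) (toℕ-fromℕ< k+1<r)))
                                         (rank≤rank-max (c (fromℕ< k+1<r)) (c k) max))

  proper⇒goodPair : ∀ {r} {c : Fin r → Elem n} → Proper n I c → ∀ u u' → u ≢ u' →
                    NotEndPair r false (toℕ u) (toℕ u') → GoodPair n I (c u) (c u')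
  proper⇒goodPair (skips , proper) u u' u≢u' notEnds with proper u u' u≢u' | notEnds
  ... | inj₁ good                  | _                  = good
  ... | inj₂ (inj₁ (min , max))    | inj₁ (_ , u'+1<r)  = ⊥-elim (max-atTop skips u' max u'+1<r)
  ... | inj₂ (inj₁ (min , max))    | inj₂ (0<u , _)     = ⊥-elim (min-atBottom skips u min 0<u)
  ... | inj₂ (inj₂ (max , min))    | inj₁ (u+1<r , _)   = ⊥-elim (max-atTop skips u max u+1<r)
  ... | inj₂ (inj₂ (max , min))    | inj₂ (_ , 0<u')    = ⊥-elim (min-atBottom skips u' min 0<u')

module CuboidGeometry {s : ℕ} (n : Fin s → ℕ) (K : Cuboid n) where
  open Cuboid K

  lookup-part : ∀ i j → lookup (part j) i ≡ ⌊ block i ≟ᶠ j ⌋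
  lookup-part i j = lookup∘tabulate (λ i → ⌊ block i ≟ᶠ j ⌋) i

  ∈part⇒block : ∀ {i j} → i ∈ part j → block i ≡ j
  ∈part⇒block {i} {j} i∈part with block i ≟ᶠ j | trans (sym ([]=⇒lookup i∈part)) (lookup-part i j)
  ... | yes i∈j | _ = i∈j

  block⇒∈part : ∀ {i j} → block i ≡ j → i ∈ part j
  block⇒∈part {i} {j} i∈j =
    lookup⇒[]= i (part j) (trans (lookup-part i j) (trans (isYes≗does (block i ≟ᶠ j)) (dec-true (block i ≟ᶠ j) i∈j)))

  embed-at : ∀ p {i j} → block i ≡ j → embed p i ≡ C j (p j) i
  embed-at p refl = refl

  embed-goodPair : ∀ (p q : Pos) j → GoodPair n (part j) (C j (p j)) (C j (q j)) → GoodPair n full (embed p) (embed q)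
  embed-goodPair p q j (i , i∈part , good) =
    i , ∈⊤ , subst₂ GoodAt (sym (embed-at p (∈part⇒block i∈part))) (sym (embed-at q (∈part⇒block i∈part))) good
    where
    GoodAt : Subset (n i) → Subset (n i) → Set
    GoodAt x y = x ≢ y × ¬ ((x ≡ ∅ × y ≡ full) ⊎ (x ≡ full × y ≡ ∅))

  rank-full : ∀ a → rank n full a ≡ sumFin (λ i → ∣ a i ∣)
  rank-full a = sumFin-cong (λ i → cong (λ b → if b then ∣ a i ∣ else 0) (lookup-replicate i inside))

  module _ (p q : Pos) (j : Fin (suc t')) (p⋖q : toℕ (q j) ≡ suc (toℕ (p j))) (p≡q : ∀ j' → j' ≢ j → p j' ≡ q j') where

    embed-⊆ : ∀ i → i ∈ full → embed p i ⊆ embed q i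
    embed-⊆ i _ with block i ≟ᶠ j
    ... | yes i∈j = subst₂ _⊆_ (sym (embed-at p i∈j)) (sym (embed-at q i∈j))
                           (proj₁ (sideChain j (p j) (q j) p⋖q) i (block⇒∈part i∈j))
    ... | no  i∉j = subst (λ x → embed p i ⊆ C (block i) x i) (p≡q (block i) i∉j) (λ x∈ → x∈)

    sideTerm : Pos → Fin s → ℕ
    sideTerm x i = if lookup (part j) i then ∣ C j (x j) i ∣ else 0

    exchange : ∀ i → ∣ embed q i ∣ + sideTerm p i ≡ ∣ embed p i ∣ + sideTerm q i
    exchange i rewrite lookup-part i j with block i ≟ᶠ j
    ... | yes i∈j rewrite embed-at p i∈j | embed-at q i∈j = +-comm ∣ C j (q j) i ∣ ∣ C j (p j) i ∣
    ... | no  i∉j = cong (λ x → ∣ C (block i) x i ∣ + 0) (sym (p≡q (block i) i∉j))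

    embed-rank : rank n full (embed q) ≡ suc (rank n full (embed p))
    embed-rank = +-cancelʳ-≡ _ _ _ (begin
      rank n full (embed q) + rank n (part j) (C j (p j))       ≡⟨ cong (_+ _) (rank-full (embed q)) ⟩
      sumFin (λ i → ∣ embed q i ∣) + sumFin (sideTerm p)        ≡⟨ sumFin-+ (λ i → ∣ embed q i ∣) (sideTerm p) ⟨
      sumFin (λ i → ∣ embed q i ∣ + sideTerm p i)               ≡⟨ sumFin-cong exchange ⟩
      sumFin (λ i → ∣ embed p i ∣ + sideTerm q i)               ≡⟨ sumFin-+ (λ i → ∣ embed p i ∣) (sideTerm q) ⟩
      sumFin (λ i → ∣ embed p i ∣) + sumFin (sideTerm q)        ≡⟨ cong (_+ _) (rank-full (embed p)) ⟨
      rank n full (embed p) + rank n (part j) (C j (q j))       ≡⟨ cong (rank n full (embed p) +_) (proj₂ (sideChain j (p j) (q j) p⋖q)) ⟩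
      rank n full (embed p) + suc (rank n (part j) (C j (p j))) ≡⟨ +-suc _ _ ⟩
      suc (rank n full (embed p)) + rank n (part j) (C j (p j)) ∎)
      where open ≡-Reasoning

-- From the grid back to the cuboid

shape : ∀ m → (Fin m → ℕ) → (Fin m → Bool) → List Side
shape zero    r v = []
shape (suc m) r v = (r zero , v zero) ∷ shape m (r ∘ suc) (v ∘ suc)

Position : ∀ m → (Fin m → ℕ) → Set
Position m r = (j : Fin m) → Fin (r j)

toPoint : ∀ {m} r v → Position m r → Point (shape m r v)
toPoint {zero}  r v x = tt
toPoint {suc m} r v x = x zero , toPoint (r ∘ suc) (v ∘ suc) (x ∘ suc)

coordinate : ∀ {m} r v → Point (shape m r v) → Position m r
coordinate {suc m} r v (u , x) zero    = u
coordinate {suc m} r v (u , x) (suc j) = coordinate (r ∘ suc) (v ∘ suc) x j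

toPoint-coordinate : ∀ {m} r v x → toPoint {m} r v (coordinate r v x) ≡ x
toPoint-coordinate {zero}  r v tt      = refl
toPoint-coordinate {suc m} r v (u , x) = cong (u ,_) (toPoint-coordinate (r ∘ suc) (v ∘ suc) x)

coordinate-toPoint : ∀ {m} r v x j → coordinate {m} r v (toPoint r v x) j ≡ x j
coordinate-toPoint {suc m} r v x zero    = refl
coordinate-toPoint {suc m} r v x (suc j) = coordinate-toPoint (r ∘ suc) (v ∘ suc) (x ∘ suc) j

toPoint-cong : ∀ {m} r v {x y} → (∀ j → x j ≡ y j) → toPoint {m} r v x ≡ toPoint r v y
toPoint-cong {zero}  r v x≡y = refl
toPoint-cong {suc m} r v x≡y = cong₂ _,_ (x≡y zero) (toPoint-cong (r ∘ suc) (v ∘ suc) (x≡y ∘ suc))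

height-shape : ∀ {m} r v x → height (shape m r v) x ≡ sumFin (λ j → toℕ (coordinate r v x j))
height-shape {zero}  r v x       = refl
height-shape {suc m} r v (u , x) = cong (toℕ u +_) (height-shape (r ∘ suc) (v ∘ suc) x)

topHeight-shape : ∀ {m} r v → topHeight (shape m r v) ≡ sumFin (λ j → r j ∸ 1)
topHeight-shape {zero}  r v = refl
topHeight-shape {suc m} r v = cong (r zero ∸ 1 +_) (topHeight-shape (r ∘ suc) (v ∘ suc))

covers-coordinate : ∀ {m} r v x y → Covers (shape m r v) x y →
  ∃[ j ] (toℕ (coordinate r v y j) ≡ suc (toℕ (coordinate r v x j)) ×
          (∀ j' → j' ≢ j → coordinate r v x j' ≡ coordinate r v y j'))
covers-coordinate {suc m} r v (u , x) (u' , _) (inj₁ (u⋖u' , refl)) = zero , u⋖u' , others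
  where
  others : ∀ j' → j' ≢ zero → coordinate r v (u , x) j' ≡ coordinate r v (u' , x) j'
  others zero     j'≢0 = ⊥-elim (j'≢0 refl)
  others (suc j') _    = refl
covers-coordinate {suc m} r v (u , x) (_ , y) (inj₂ (refl , x⋖y))
  with covers-coordinate (r ∘ suc) (v ∘ suc) x y x⋖y
... | j , x⋖y-at-j , others = suc j , x⋖y-at-j , others′
  where
  others′ : ∀ j' → j' ≢ suc j → coordinate r v (u , x) j' ≡ coordinate r v (u , y) j'
  others′ zero     _     = refl
  others′ (suc j') j'≢j = others j' (j'≢j ∘ cong suc)

separated-coordinate : ∀ {m} r v x y → Separated (shape m r v) x y →
  ∃[ j ] (coordinate r v x j ≢ coordinate r v y j ×
          NotEndPair (r j) (v j) (toℕ (coordinate r v x j)) (toℕ (coordinate r v y j)))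
separated-coordinate {suc m} r v (u , x) (u' , y) (inj₁ apart) = zero , apart
separated-coordinate {suc m} r v (u , x) (u' , y) (inj₂ x∥y)
  with separated-coordinate (r ∘ suc) (v ∘ suc) x y x∥y
... | j , apart = suc j , apart

allLong-shape : ∀ {m} r v → (∀ j → v j ≡ false → 5 ≤ r j) → All LongIfProper (shape m r v)
allLong-shape {zero}  r v long = []
allLong-shape {suc m} r v long = long zero ∷ allLong-shape (r ∘ suc) (v ∘ suc) (long ∘ suc)

module _ {s : ℕ} (n : Fin s → ℕ) (K : Cuboid n) where
  open Cuboid K
  open CuboidGeometry n K

  module Lift (v : Fin (suc t') → Bool) (F : ChainFamily (shape (suc t') r v)) where
    open ChainFamily F hiding (OnChain)
    open Inverse enumeration using (strictlyInverseˡ; strictlyInverseʳ) renaming (from to indexOf)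

    chainAt : Fin size → Index
    chainAt = Inverse.to enumeration

    ch : (d : Fin size) → Fin (suc (len (chainAt d))) → Pos
    ch d k = coordinate r v (chain (chainAt d) k)

    ch-step : ∀ d (k k' : Fin (suc (len (chainAt d)))) → toℕ k' ≡ suc (toℕ k) →
              (ch d k ≤C ch d k') × crank (ch d k') ≡ suc (crank (ch d k))
    ch-step d k k' k⋖k' = ≤C , crank-⋖
      where
      x = chain (chainAt d) k
      y = chain (chainAt d) k'
      x⋖y = covers (chainAt d) k k' k⋖k'
      ls = shape (suc t') r v
      ≤C : ch d k ≤C ch d k'
      ≤C j' with covers-coordinate r v x y x⋖y
      ... | j , x⋖y-at-j , others with j' ≟ᶠ j
      ...   | yes refl = ≤-trans (n≤1+n _) (≤-reflexive (sym x⋖y-at-j))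
      ...   | no  j'≢j = ≤-reflexive (cong toℕ (others j' j'≢j))
      crank-⋖ : crank (ch d k') ≡ suc (crank (ch d k))
      crank-⋖ = begin
        crank (coordinate r v y)  ≡⟨ height-shape r v y ⟨
        height ls y               ≡⟨ covers-height ls x y x⋖y ⟩
        suc (height ls x)         ≡⟨ cong suc (height-shape r v x) ⟩
        suc (crank (coordinate r v x)) ∎
        where open ≡-Reasoning

    ch-symmetric : ∀ d → crank (ch d zero) + crank (ch d (fromℕ (len (chainAt d)))) ≡ topRank
    ch-symmetric d = trans (cong₂ _+_ (sym (height-shape r v (chain (chainAt d) zero)))
                                      (sym (height-shape r v (chain (chainAt d) (fromℕ (len (chainAt d)))))))
                           (trans (symmetric (chainAt d)) (topHeight-shape r v))

    ch-veryProper : (∀ j (u u' : Fin (r j)) → u ≢ u' → NotEndPair (r j) (v j) (toℕ u) (toℕ u') →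
                      GoodPair n (part j) (C j u) (C j u')) →
                    ∀ d → VeryProper n full (λ k → embed (ch d k))
    ch-veryProper sideGood d = skips , good
      where
      skips : SkipsNoRanks n full (λ k → embed (ch d k))
      skips k k' k⋖k' with covers-coordinate r v _ _ (covers (chainAt d) k k' k⋖k')
      ... | j , x⋖y-at-j , others = embed-⊆ (ch d k) (ch d k') j x⋖y-at-j others ,
                                    embed-rank (ch d k) (ch d k') j x⋖y-at-j others
      good : ∀ k k' → k ≢ k' → GoodPair n full (embed (ch d k)) (embed (ch d k'))
      good k k' k≢k' with separated-coordinate r v _ _ (separated (chainAt d) k k' k≢k')
      ... | j , apart , notEnds = embed-goodPair (ch d k) (ch d k') j (sideGood j _ _ apart notEnds)

    reindex : ∀ {i i'} → i' ≡ i → ∀ k → ∃[ k' ] (chain i' k' ≡ chain i k)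
    reindex refl k = k , refl

    ch-cover : (∀ x → OnChain F x) → ∀ p → ∃[ d ] ∃[ k ] (ch d k ≈P p)
    ch-cover onChain p with onChain (toPoint r v p)
    ... | i , k , on-i with reindex (strictlyInverseˡ i) k
    ...   | k' , same = indexOf i , k' , λ j → trans (cong (λ x → coordinate r v x j) (trans same on-i))
                                                      (coordinate-toPoint r v p j)

    ch-disjoint : ∀ d d' k k' → ch d k ≈P ch d' k' → Σ (d ≡ d') (λ _ → toℕ k ≡ toℕ k')
    ch-disjoint d d' k k' same with injective (chainAt d) (chainAt d') k k'
      (trans (sym (toPoint-coordinate r v _)) (trans (toPoint-cong r v same) (toPoint-coordinate r v _)))
    ... | d≡d' , k≡k' = trans (sym (strictlyInverseʳ d)) (trans (cong indexOf d≡d') (strictlyInverseʳ d')) , k≡k'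

  liftDecomposition : (v : Fin (suc t') → Bool) →
    (∀ j (u u' : Fin (r j)) → u ≢ u' → NotEndPair (r j) (v j) (toℕ u) (toℕ u') → GoodPair n (part j) (C j u) (C j u')) →
    Decomposition (shape (suc t') r v) → VPDecomposition n K
  liftDecomposition v sideGood (F , onChain) = record
    { D = size ; len = len ∘ chainAt ; ch = ch ; step = ch-step ; symmetric = ch-symmetric
    ; veryProperInP = ch-veryProper sideGood ; cover = ch-cover onChain ; disjoint = ch-disjoint }
    where
    open Lift v F
    open ChainFamily F using (size; len)

  -- Condition (∗) makes every side of length at most 4 very proper.
  sideFlag : Fin (suc t') → Bool
  sideFlag zero    = true
  sideFlag (suc j) = ⌊ r (suc j) ≤? 4 ⌋

  sideFlag-long : ∀ j → sideFlag (suc j) ≡ false → 5 ≤ r (suc j)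
  sideFlag-long j flag≡false with r (suc j) ≤? 4
  ... | no r≰4 = ≰⇒> r≰4

  sideFlag-goodPair : Star n K → VeryProper n (part zero) (C zero) →
    ∀ j (u u' : Fin (r j)) → u ≢ u' → NotEndPair (r j) (sideFlag j) (toℕ u) (toℕ u') → GoodPair n (part j) (C j u) (C j u')
  sideFlag-goodPair star vp₀ zero u u' u≢u' _ = proj₂ vp₀ u u' u≢u'
  sideFlag-goodPair star vp₀ (suc j) u u' u≢u' notEnds with r (suc j) ≤? 4
  ... | yes r≤4 = proj₂ (proj₂ (star (suc j)) r≤4) u u' u≢u'
  ... | no  _   = proper⇒goodPair n (part (suc j)) (proj₁ (star (suc j))) u u' u≢u' notEnds

lemma8p3 : ∀ {s : ℕ} (n : Fin s → ℕ) → (∀ i → 2 ≤ n i) →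
    (K : Cuboid n) → Star n K →
    3 ≤ Cuboid.r K zero →
    VeryProper n (Cuboid.part K zero) (Cuboid.C K zero) →
    VPDecomposition n K
lemma8p3 n _ K star 3≤r₀ vp₀ =
  liftDecomposition n K (sideFlag n K) (sideFlag-goodPair n K star vp₀)
    (decompose _ (r zero) tail ≤-refl (allLong-shape (r ∘ suc) (sideFlag n K ∘ suc) (sideFlag-long n K)) (inj₁ 3≤r₀))
  where
  open Cuboid K
  tail = shape t' (r ∘ suc) (sideFlag n K ∘ suc)
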